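{- Let $q=p^t$ with $p$ prime and $t\ge1$. Let $V$ be an $n$-dimensional vector space over $\mathbb{F}_q$, let $k$ be a positive integer with $k\le n/2$, and let $\mathcal{S}^*$ be a family of $s$ subspaces of $V$ of codimension $k$, with $s\ge 2$, such that for some integer $d\ge2$: (1) for every $v\in V\setminus\{0\}$, $|\{M\in\mathcal{S}^*: v\in M\}|\in\{0,d\}$, with both values occurring; and (2) $\dim(M\cap M^*)=n-2k$ for all distinct $M,M^*\in\mathcal{S}^*$. Then $d=q^{n-2k}\cdot p^{ -i}$ for some nonnegative integer $i$. -}

module Defs where

open import Data.Nat using (ℕ; zero; suc; _+_)
open import Data.Fin using (Fin; zero; suc)
open import Data.Vec using (Vec; replicate; zipWith; map)
open import Data.Bool using (if_then_else_)
open import Data.Product using (Σ; ∃; _×_)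
open import Relation.Nullary using (Dec; does)
open import Relation.Binary.PropositionalEquality using (_≡_; _≢_)
open import Algebra.Structures using (IsCommutativeRing)
open import Function using (_∘_)
open import Function.Bundles using (_↔_)

record FiniteField (q : ℕ) : Set₁ where
  infixl 6 _+F_
  infixl 7 _*F_
  field
    Carrier : Set
    _+F_ _*F_ : Carrier → Carrier → Carrier
    -F_ : Carrier → Carrier
    0# 1# : Carrier
    isCommutativeRing : IsCommutativeRing _≡_ _+F_ _*F_ -F_ 0# 1#
    0≢1 : 0# ≢ 1#
    inverse : ∀ x → x ≢ 0# → ∃ λ y → x *F y ≡ 1#
    enumeration : Carrier ↔ Fin q

module _ {q : ℕ} (F : FiniteField q) (n : ℕ) where
  open FiniteField F

  Vect : Set
  Vect = Vec Carrier n

  0v : Vect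
  0v = replicate n 0#

  _+v_ : Vect → Vect → Vect
  _+v_ = zipWith _+F_

  _·v_ : Carrier → Vect → Vect
  c ·v v = map (c *F_) v

  -- a subspace of F^n (membership decidable; automatic for finite F)
  record Subspace : Set₁ where
    field
      mem : Vect → Set
      mem? : ∀ v → Dec (mem v)
      zero-mem : mem 0v
      +-mem : ∀ u v → mem u → mem v → mem (u +v v)
      ·-mem : ∀ c v → mem v → mem (c ·v v)

  lincomb : ∀ {m} → (Fin m → Vect) → (Fin m → Carrier) → Vect
  lincomb {zero} b c = 0v
  lincomb {suc m} b c = (c zero ·v b zero) +v lincomb (b ∘ suc) (c ∘ suc)

  HasDim : (Vect → Set) → ℕ → Set
  HasDim P m = Σ (Fin m → Vect) λ b →
      (∀ i → P (b i))
    × (∀ c → lincomb b c ≡ 0v → ∀ i → c i ≡ 0#)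
    × (∀ v → P v → ∃ λ c → lincomb b c ≡ v)

  count : ∀ {s} → (Fin s → Subspace) → Vect → ℕ
  count {zero} M v = 0
  count {suc s} M v =
    (if does (Subspace.mem? (M zero) v) then 1 else 0) + count (M ∘ suc) v

{-# OPTIONS --safe #-}
-- Write B = q ^ (n - k) and A = q ^ (n - 2k) for the sizes of the Mᵢ and of their pairwise
-- intersections, and mult v for the number of Mᵢ containing v, so that mult v ∈ {0, d} for v ≠ 0.
-- Summing mult over M₀, over the whole space, over a coset of M₀ avoiding 0, and over an affine
-- hyperplane c · v = 1 where c vanishes on no Mᵢ gives
--   (B - 1) d = (B - 1) + (s - 1)(A - 1),  s (B - 1) ≤ d (q ^ n - 2),  d ∣ (s - 1) A,  d ∣ s B.
-- Such a c exists because each Mᵢ is annihilated by only q ^ k functionals, and the first two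
-- relations leave too few Mᵢ to account for all nonzero functionals.  Hence d divides B, a power
-- of p, so d = p ^ α; were α larger than the exponent of A, p would divide s - 1 and then, by the
-- first relation, B - 1 as well.
module Submission where

open import Defs
open import Algebra.Bundles using (CommutativeRing; AbelianGroup)
import Algebra.Properties.AbelianGroup
import Algebra.Properties.CommutativeSemigroup
import Algebra.Properties.Ring
import Algebra.Properties.Semiring.Sum as SemiringSum
open import Data.Bool using (if_then_else_)
open import Data.Empty using (⊥; ⊥-elim)
open import Data.Fin using (Fin; zero; suc)
import Data.Fin.Properties as Fin
open import Data.Nat using (ℕ; zero; suc; pred; _+_; _*_; _∸_; _^_; _≤_; _≤?_; z≤n; s≤s; NonZero; >-nonZero)
open import Data.Nat.Coprimality using (Coprime; coprime-divisor)
open import Data.Nat.Divisibility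
  using ( _∣_; _∣0; _∣?_; ∣-refl; ∣-trans; divides; ∣m∣n⇒∣m+n; ∣m+n∣m⇒∣n; ∣1⇒≡1; *-cancelʳ-∣
        ; m∣m*n; ∣m⇒∣m*n; ∣n⇒∣m*n)
open import Data.Nat.Primality using (Prime; prime⇒nonZero; prime⇒irreducible; ¬prime[1])
open import Data.Nat.Properties hiding (_≟_)
open import Data.Nat.Tactic.RingSolver using (solve-∀)
open import Data.Product using (∃; _×_; _,_; proj₁; proj₂; uncurry)
open import Data.Product.Function.NonDependent.Propositional using (_×-↔_)
open import Data.Sum using (_⊎_; inj₁; inj₂)
open import Data.Unit using (⊤; tt)
open import Data.Vec using (Vec; []; _∷_; map; lookup; tabulate)
import Data.Vec.Properties as Vec
open import Function using (_∘_; _↔_; Inverse; Injection; mk↔ₛ′)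
open import Function.Properties.Inverse using (↔-refl; ↔-sym; ↔-trans; ↔⇒↣)
open import Relation.Binary.Definitions using (DecidableEquality)
open import Relation.Binary.PropositionalEquality
open import Relation.Nullary using (Dec; yes; no; does; ¬_; contradiction)
open import Relation.Nullary.Decidable using (map′; via-injection; _×-dec_; ¬?; decidable-stable)

open SemiringSum +-*-semiring using (sum; sum-cong-≗; ∑-distrib-+; *-distribˡ-sum; sum-permute)
open Algebra.Properties.CommutativeSemigroup *-commutativeSemigroup using (x∙yz≈y∙xz)

-- Indicators and finite sums

𝟙 : ∀ {p} {P : Set p} → Dec P → ℕ
𝟙 (yes _) = 1
𝟙 (no _) = 0

𝟙-yes : ∀ {p} {P : Set p} (P? : Dec P) → P → 𝟙 P? ≡ 1
𝟙-yes (yes _) _ = refl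
𝟙-yes (no ¬p) p = contradiction p ¬p

𝟙-no : ∀ {p} {P : Set p} (P? : Dec P) → ¬ P → 𝟙 P? ≡ 0
𝟙-no (yes p) ¬p = contradiction p ¬p
𝟙-no (no _) _ = refl

𝟙-cong : ∀ {p q} {P : Set p} {Q : Set q} (P? : Dec P) (Q? : Dec Q) →
         (P → Q) → (Q → P) → 𝟙 P? ≡ 𝟙 Q?
𝟙-cong (yes _) (yes _) _ _ = refl
𝟙-cong (yes p) (no ¬q) to _ = contradiction (to p) ¬q
𝟙-cong (no ¬p) (yes q) _ from = contradiction (from q) ¬p
𝟙-cong (no _) (no _) _ _ = refl

𝟙-idem : ∀ {p} {P : Set p} (P? : Dec P) → 𝟙 P? * 𝟙 P? ≡ 𝟙 P?
𝟙-idem (yes _) = refl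
𝟙-idem (no _) = refl

𝟙*-cong : ∀ {p} {P : Set p} (P? : Dec P) {x y} → (P → x ≡ y) → 𝟙 P? * x ≡ 𝟙 P? * y
𝟙*-cong (yes p) x≡y = cong (_+ 0) (x≡y p)
𝟙*-cong (no _) _ = refl

𝟙-× : ∀ {p q} {P : Set p} {Q : Set q} (P? : Dec P) (Q? : Dec Q) → 𝟙 (P? ×-dec Q?) ≡ 𝟙 P? * 𝟙 Q?
𝟙-× (yes _) (yes _) = refl
𝟙-× (yes _) (no _) = refl
𝟙-× (no _) _ = refl

sum-const : ∀ n c → sum {n} (λ _ → c) ≡ n * c
sum-const zero c = refl
sum-const (suc n) c = cong (c +_) (sum-const n c)

sum-mono-≤ : ∀ {n} {f g : Fin n → ℕ} → (∀ i → f i ≤ g i) → sum f ≤ sum g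
sum-mono-≤ {zero} _ = z≤n
sum-mono-≤ {suc n} f≤g = +-mono-≤ (f≤g zero) (sum-mono-≤ (f≤g ∘ suc))

∣-sum : ∀ {d n} {f : Fin n → ℕ} → (∀ i → d ∣ f i) → d ∣ sum f
∣-sum {d} {zero} _ = d ∣0
∣-sum {n = suc n} d∣f = ∣m∣n⇒∣m+n (d∣f zero) (∣-sum (d∣f ∘ suc))

lookup≤sum : ∀ {n} (f : Fin n → ℕ) i → f i ≤ sum f
lookup≤sum f zero = m≤m+n _ _
lookup≤sum f (suc i) = ≤-trans (lookup≤sum (f ∘ suc) i) (m≤n+m _ _)

+-tight : ∀ {a b c d} → a ≤ c → b ≤ d → a + b ≡ c + d → a ≡ c × b ≡ d
+-tight {a} {b} {c} {d} a≤c b≤d eq =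
    ≤-antisym a≤c (+-cancelʳ-≤ d c a (subst (_≤ a + d) eq (+-monoʳ-≤ a b≤d)))
  , ≤-antisym b≤d (+-cancelˡ-≤ c d b (subst (_≤ c + b) eq (+-monoˡ-≤ b a≤c)))

sum≤n*c : ∀ {n c} {f : Fin n → ℕ} → (∀ i → f i ≤ c) → sum f ≤ n * c
sum≤n*c {n} {c} f≤c = ≤-trans (sum-mono-≤ f≤c) (≤-reflexive (sum-const n c))

sum-tight : ∀ {n c} {f : Fin n → ℕ} → (∀ i → f i ≤ c) → sum f ≡ n * c → ∀ i → f i ≡ c
sum-tight f≤c eq zero    = proj₁ (+-tight (f≤c zero) (sum≤n*c (f≤c ∘ suc)) eq)
sum-tight f≤c eq (suc i) = sum-tight (f≤c ∘ suc) (proj₂ (+-tight (f≤c zero) (sum≤n*c (f≤c ∘ suc)) eq)) i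

sum-δ : ∀ {n} (j : Fin n) → sum (λ i → 𝟙 (i Fin.≟ j)) ≡ 1
sum-δ {suc n} zero =
  cong suc (trans (sum-cong-≗ {n} (λ i → 𝟙-no (suc i Fin.≟ zero) λ ())) (trans (sum-const n 0) (*-zeroʳ n)))
sum-δ {suc n} (suc j) =
  trans (sum-cong-≗ {n} (λ i → 𝟙-cong (suc i Fin.≟ suc j) (i Fin.≟ j) Fin.suc-injective (cong suc))) (sum-δ j)

record Finite (X : Set) : Set where
  field
    size : ℕ
    enum : X ↔ Fin size

open Finite {{...}} public

module _ {X : Set} {{X-finite : Finite X}} where

  private
    open module E = Inverse enum using (to; from)

  _≟_ : DecidableEquality X
  _≟_ = via-injection (↔⇒↣ enum) Fin._≟_

  -- Opaque, so that unification never unfolds a sum and the summation domain stays inferable.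
  opaque
    ∑ : (X → ℕ) → ℕ
    ∑ f = sum (f ∘ from)

  opaque
    unfolding ∑

    ∑-cong : ∀ {f g : X → ℕ} → (∀ x → f x ≡ g x) → ∑ f ≡ ∑ g
    ∑-cong f≗g = sum-cong-≗ {size} (f≗g ∘ from)

    ∑-+ : ∀ (f g : X → ℕ) → ∑ (λ x → f x + g x) ≡ ∑ f + ∑ g
    ∑-+ f g = ∑-distrib-+ (f ∘ from) (g ∘ from)

    ∑-*ˡ : ∀ c (f : X → ℕ) → ∑ (λ x → c * f x) ≡ c * ∑ f
    ∑-*ˡ c f = sym (*-distribˡ-sum c (f ∘ from))

    ∑-*ʳ : ∀ c (f : X → ℕ) → ∑ (λ x → f x * c) ≡ ∑ f * c
    ∑-*ʳ c f = trans (∑-cong (λ x → *-comm (f x) c)) (trans (∑-*ˡ c f) (*-comm c (∑ f)))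

    ∑-const : ∀ c → ∑ (λ _ → c) ≡ size * c
    ∑-const = sum-const size

    ∑-zero : ∀ {f : X → ℕ} → (∀ x → f x ≡ 0) → ∑ f ≡ 0
    ∑-zero f≡0 = trans (∑-cong f≡0) (trans (∑-const 0) (*-zeroʳ size))

    ∑-mono-≤ : ∀ {f g : X → ℕ} → (∀ x → f x ≤ g x) → ∑ f ≤ ∑ g
    ∑-mono-≤ f≤g = sum-mono-≤ (f≤g ∘ from)

    ∣-∑ : ∀ {d} {f : X → ℕ} → (∀ x → d ∣ f x) → d ∣ ∑ f
    ∣-∑ d∣f = ∣-sum (d∣f ∘ from)

    term≤∑ : ∀ (f : X → ℕ) x → f x ≤ ∑ f
    term≤∑ f x = subst (λ y → f y ≤ ∑ f) (E.strictlyInverseʳ x) (lookup≤sum (f ∘ from) (to x))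

    ∑-tight : ∀ {c} {f : X → ℕ} → (∀ x → f x ≤ c) → ∑ f ≡ size * c → ∀ x → f x ≡ c
    ∑-tight {f = f} f≤c eq x =
      subst (λ y → f y ≡ _) (E.strictlyInverseʳ x) (sum-tight (f≤c ∘ from) eq (to x))

    ∑-δ : ∀ x₀ → ∑ (λ x → 𝟙 (x ≟ x₀)) ≡ 1
    ∑-δ x₀ = trans (sum-cong-≗ {size} λ i → 𝟙-cong (from i ≟ x₀) (i Fin.≟ to x₀)
                     (λ e → trans (sym (E.strictlyInverseˡ i)) (cong to e))
                     (λ e → trans (cong from e) (E.strictlyInverseʳ x₀)))
                   (sum-δ (to x₀))

    ∑-reindex : (σ : X ↔ X) (f : X → ℕ) → ∑ (f ∘ Inverse.to σ) ≡ ∑ f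
    ∑-reindex σ f = trans (sum-cong-≗ {size} λ i → cong f (sym (E.strictlyInverseʳ _)))
                          (sym (sum-permute (f ∘ from) (↔-trans (↔-sym enum) (↔-trans σ enum))))

  ∑-δ′ : ∀ x₀ → ∑ (λ x → 𝟙 (x₀ ≟ x)) ≡ 1
  ∑-δ′ x₀ = trans (∑-cong λ x → 𝟙-cong (x₀ ≟ x) (x ≟ x₀) sym sym) (∑-δ x₀)

  ∑-δ-*ʳ : ∀ x₀ c → ∑ (λ x → 𝟙 (x ≟ x₀) * c) ≡ c
  ∑-δ-*ʳ x₀ c = trans (∑-*ʳ c _) (trans (cong (_* c) (∑-δ x₀)) (*-identityˡ c))

  ∃? : ∀ {p} {P : X → Set p} → (∀ x → Dec (P x)) → Dec (∃ P)
  ∃? {P = P} P? = map′ (λ (i , p) → from i , p) (λ (x , p) → to x , subst P (sym (E.strictlyInverseʳ x)) p)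
                       (Fin.any? (P? ∘ from))

opaque
  unfolding ∑
  ∑-comm : ∀ {X Y : Set} {{_ : Finite X}} {{_ : Finite Y}} (f : X → Y → ℕ) →
           ∑ (λ x → ∑ (f x)) ≡ ∑ (λ y → ∑ (λ x → f x y))
  ∑-comm f = SemiringSum.∑-comm +-*-semiring (λ i j → f (Inverse.from enum i) (Inverse.from enum j))

instance
  Fin-finite : ∀ {n} → Finite (Fin n)
  Fin-finite = record { enum = ↔-refl }

  Vec-finite : ∀ {A : Set} {{_ : Finite A}} {m} → Finite (Vec A m)
  Vec-finite {A} {m = m} = record { enum = Vec↔Fin m }
    where
    Vec↔× : ∀ {m} → Vec A (suc m) ↔ (A × Vec A m)
    Vec↔× = mk↔ₛ′ (λ { (x ∷ xs) → x , xs }) (uncurry _∷_) (λ _ → refl) (λ { (x ∷ xs) → refl })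
    Vec↔Fin : ∀ m → Vec A m ↔ Fin (size {A} ^ m)
    Vec↔Fin zero = mk↔ₛ′ (λ _ → zero) (λ _ → []) (λ { zero → refl }) (λ { [] → refl })
    Vec↔Fin (suc m) = ↔-trans Vec↔× (↔-trans (enum {A} ×-↔ Vec↔Fin m) (↔-sym Fin.*↔×))

opaque
  unfolding ∑
  ∑-Fin-suc : ∀ {n} (f : Fin (suc n) → ℕ) → ∑ f ≡ f zero + ∑ (f ∘ suc)
  ∑-Fin-suc f = refl

-- Vectors and subspaces over a finite field

module VectorSpace {q : ℕ} (F : FiniteField q) where

  open FiniteField F

  private
    ring : CommutativeRing _ _
    ring = record { isCommutativeRing = isCommutativeRing }
    module R = CommutativeRing ring
    module RP = Algebra.Properties.Ring R.ring
    module F+ = Algebra.Properties.CommutativeSemigroup R.+-commutativeSemigroup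
    module F* = Algebra.Properties.CommutativeSemigroup R.*-commutativeSemigroup

  instance
    Carrier-finite : Finite Carrier
    Carrier-finite = record { enum = enumeration }

  2≤q : 2 ≤ q
  2≤q = distinct⇒2≤ (Inverse.to enumeration 0#) (Inverse.to enumeration 1#)
                    (0≢1 ∘ Injection.injective (↔⇒↣ enumeration))
    where
    distinct⇒2≤ : ∀ {m} (i j : Fin m) → i ≢ j → 2 ≤ m
    distinct⇒2≤ {suc zero} zero zero i≢j = contradiction refl i≢j
    distinct⇒2≤ {suc (suc m)} _ _ _ = s≤s (s≤s z≤n)

  infixl 6 _+ᵥ_
  infixr 7 _·ᵥ_

  _+ᵥ_ : ∀ {n} → Vect F n → Vect F n → Vect F n
  _+ᵥ_ {n} = _+v_ F n

  _·ᵥ_ : ∀ {n} → Carrier → Vect F n → Vect F n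
  _·ᵥ_ {n} = _·v_ F n

  0ᵥ : ∀ {n} → Vect F n
  0ᵥ {n} = 0v F n

  -ᵥ_ : ∀ {n} → Vect F n → Vect F n
  -ᵥ_ = map -F_

  Vect-abelianGroup : ℕ → AbelianGroup _ _
  Vect-abelianGroup n = record
    { _≈_ = _≡_ ; _∙_ = _+ᵥ_ {n} ; ε = 0ᵥ ; _⁻¹ = -ᵥ_
    ; isAbelianGroup = record
      { isGroup = record
        { isMonoid = record
          { isSemigroup = record
            { isMagma = record { isEquivalence = isEquivalence ; ∙-cong = cong₂ _+ᵥ_ }
            ; assoc = Vec.zipWith-assoc R.+-assoc }
          ; identity = Vec.zipWith-identityˡ R.+-identityˡ , Vec.zipWith-identityʳ R.+-identityʳ }
        ; inverse = Vec.zipWith-inverseˡ R.-‿inverseˡ , Vec.zipWith-inverseʳ R.-‿inverseʳ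
        ; ⁻¹-cong = cong -ᵥ_ }
      ; comm = Vec.zipWith-comm R.+-comm } }

  module _ {n : ℕ} where
    open AbelianGroup (Vect-abelianGroup n) public
      using () renaming ( assoc to +ᵥ-assoc; comm to +ᵥ-comm; identityʳ to +ᵥ-identityʳ
                        ; inverseʳ to +ᵥ-inverseʳ)
    open Algebra.Properties.AbelianGroup (Vect-abelianGroup n) public
      using () renaming ( //-rightDividesˡ to [u-w]+w≡u; //-rightDividesʳ to [u+w]-w≡u
                        ; ⁻¹-∙-comm to -ᵥ‿+ᵥ-comm; ε⁻¹≈ε to -ᵥ0ᵥ≡0ᵥ)
    open Algebra.Properties.CommutativeSemigroup (AbelianGroup.commutativeSemigroup (Vect-abelianGroup n)) public
      using () renaming (interchange to +ᵥ-interchange)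

  -‿·ᵥ : ∀ {n} a (v : Vect F n) → (-F a) ·ᵥ v ≡ -ᵥ (a ·ᵥ v)
  -‿·ᵥ a v = trans (Vec.map-cong (λ x → sym (RP.-‿distribˡ-* a x)) v) (Vec.map-∘ -F_ (a *F_) v)

  ·ᵥ-distribʳ : ∀ {n} a b (v : Vect F n) → (a +F b) ·ᵥ v ≡ a ·ᵥ v +ᵥ b ·ᵥ v
  ·ᵥ-distribʳ a b [] = refl
  ·ᵥ-distribʳ a b (x ∷ v) = cong₂ _∷_ (R.distribʳ x a b) (·ᵥ-distribʳ a b v)

  dot : ∀ {n} → Vect F n → Vect F n → Carrier
  dot [] [] = 0#
  dot (x ∷ u) (y ∷ v) = x *F y +F dot u v

  dot-comm : ∀ {n} (u v : Vect F n) → dot u v ≡ dot v u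
  dot-comm [] [] = refl
  dot-comm (x ∷ u) (y ∷ v) = cong₂ _+F_ (R.*-comm x y) (dot-comm u v)

  dot-0ʳ : ∀ {n} (c : Vect F n) → dot c 0ᵥ ≡ 0#
  dot-0ʳ [] = refl
  dot-0ʳ (x ∷ c) = trans (cong₂ _+F_ (R.zeroʳ x) (dot-0ʳ c)) (R.+-identityʳ 0#)

  dot-+ʳ : ∀ {n} (c u v : Vect F n) → dot c (u +ᵥ v) ≡ dot c u +F dot c v
  dot-+ʳ [] [] [] = sym (R.+-identityʳ 0#)
  dot-+ʳ (x ∷ c) (y ∷ u) (z ∷ v) =
    trans (cong₂ _+F_ (R.distribˡ x y z) (dot-+ʳ c u v)) (F+.interchange _ _ _ _)

  dot-·ʳ : ∀ {n} (c : Vect F n) a v → dot c (a ·ᵥ v) ≡ a *F dot c v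
  dot-·ʳ [] a [] = sym (R.zeroʳ a)
  dot-·ʳ (x ∷ c) a (y ∷ v) = trans (cong₂ _+F_ (F*.x∙yz≈y∙xz x a y) (dot-·ʳ c a v)) (sym (R.distribˡ a _ _))

  ≢0ᵥ⇒∃dot≡1 : ∀ {n} (v : Vect F n) → v ≢ 0ᵥ → ∃ λ c → dot v c ≡ 1#
  ≢0ᵥ⇒∃dot≡1 [] v≢0 = contradiction refl v≢0
  ≢0ᵥ⇒∃dot≡1 (x ∷ v) x∷v≢0 with x ≟ 0#
  ... | no x≢0 = let (x⁻¹ , x*x⁻¹≡1) = inverse x x≢0 in
    x⁻¹ ∷ 0ᵥ , trans (cong₂ _+F_ x*x⁻¹≡1 (dot-0ʳ v)) (R.+-identityʳ 1#)
  ... | yes refl = let (c , v·c≡1) = ≢0ᵥ⇒∃dot≡1 v (x∷v≢0 ∘ cong (0# ∷_)) in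
    0# ∷ c , trans (cong₂ _+F_ (R.zeroˡ 0#) v·c≡1) (R.+-identityˡ 1#)

  module _ {n : ℕ} where

    lincomb-neg : ∀ {m} (b : Fin m → Vect F n) c → lincomb F n b (-F_ ∘ c) ≡ -ᵥ lincomb F n b c
    lincomb-neg {zero} b c = sym -ᵥ0ᵥ≡0ᵥ
    lincomb-neg {suc m} b c =
      trans (cong₂ _+ᵥ_ (-‿·ᵥ (c zero) (b zero)) (lincomb-neg (b ∘ suc) (c ∘ suc))) (-ᵥ‿+ᵥ-comm _ _)

    lincomb-+ : ∀ {m} (b : Fin m → Vect F n) c c′ →
                lincomb F n b (λ i → c i +F c′ i) ≡ lincomb F n b c +ᵥ lincomb F n b c′
    lincomb-+ {zero} b c c′ = sym (+ᵥ-identityʳ 0ᵥ)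
    lincomb-+ {suc m} b c c′ =
      trans (cong₂ _+ᵥ_ (·ᵥ-distribʳ (c zero) (c′ zero) (b zero))
                        (lincomb-+ (b ∘ suc) (c ∘ suc) (c′ ∘ suc)))
            (+ᵥ-interchange _ _ _ _)

    lincomb-cong : ∀ {m} (b : Fin m → Vect F n) {c c′} → (∀ i → c i ≡ c′ i) →
                   lincomb F n b c ≡ lincomb F n b c′
    lincomb-cong {zero} b c≗c′ = refl
    lincomb-cong {suc m} b c≗c′ =
      cong₂ _+ᵥ_ (cong (_·ᵥ b zero) (c≗c′ zero)) (lincomb-cong (b ∘ suc) (c≗c′ ∘ suc))

    lincomb-injective : ∀ {m} (b : Fin m → Vect F n) →
                        (∀ c → lincomb F n b c ≡ 0ᵥ → ∀ i → c i ≡ 0#) →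
                        ∀ {c c′} → lincomb F n b c ≡ lincomb F n b c′ → ∀ i → c i ≡ c′ i
    lincomb-injective b independent {c} {c′} eq i =
      RP.x∙y⁻¹≈ε⇒x≈y (c i) (c′ i) (independent (λ j → c j +F -F c′ j) combination≡0 i)
      where
      combination≡0 : lincomb F n b (λ j → c j +F -F c′ j) ≡ 0ᵥ
      combination≡0 = begin
        lincomb F n b (λ j → c j +F -F c′ j)                ≡⟨ lincomb-+ b c (-F_ ∘ c′) ⟩
        lincomb F n b c +ᵥ lincomb F n b (-F_ ∘ c′)          ≡⟨ cong₂ _+ᵥ_ eq (lincomb-neg b c′) ⟩
        lincomb F n b c′ +ᵥ -ᵥ lincomb F n b c′             ≡⟨ +ᵥ-inverseʳ _ ⟩
        0ᵥ                                                   ∎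
        where open ≡-Reasoning

  module _ {n : ℕ} (S : Subspace F n) where
    open Subspace S

    -‿mem : ∀ {v} → mem v → mem (-ᵥ v)
    -‿mem {v} v∈S = subst mem (Vec.map-cong (RP.-1*x≈-x) v) (·-mem (-F 1#) v v∈S)

    +-mem⁻¹ˡ : ∀ {u t} → mem t → mem (u +ᵥ t) → mem u
    +-mem⁻¹ˡ {u} {t} t∈S u+t∈S = subst mem ([u+w]-w≡u t u) (+-mem _ _ u+t∈S (-‿mem t∈S))

    +-mem⁻¹ʳ : ∀ {u t} → mem u → mem (u +ᵥ t) → mem t
    +-mem⁻¹ʳ {u} {t} u∈S u+t∈S = +-mem⁻¹ˡ u∈S (subst mem (+ᵥ-comm u t) u+t∈S)

    lincomb-mem : ∀ {m} (b : Fin m → Vect F n) → (∀ i → mem (b i)) → ∀ c → mem (lincomb F n b c)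
    lincomb-mem {zero} b b∈S c = zero-mem
    lincomb-mem {suc m} b b∈S c =
      +-mem _ _ (·-mem (c zero) (b zero) (b∈S zero)) (lincomb-mem (b ∘ suc) (b∈S ∘ suc) (c ∘ suc))

  module _ {n : ℕ} where

    ⊤ˢ : Subspace F n
    ⊤ˢ = record
      { mem = λ _ → ⊤ ; mem? = λ _ → yes tt ; zero-mem = tt ; +-mem = λ _ _ _ _ → tt ; ·-mem = λ _ _ _ → tt }

    infixr 7 _∩ˢ_
    _∩ˢ_ : Subspace F n → Subspace F n → Subspace F n
    S ∩ˢ T = record
      { mem = λ v → S.mem v × T.mem v
      ; mem? = λ v → S.mem? v ×-dec T.mem? v
      ; zero-mem = S.zero-mem , T.zero-mem
      ; +-mem = λ u v (u∈S , u∈T) (v∈S , v∈T) → S.+-mem u v u∈S v∈S , T.+-mem u v u∈T v∈T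
      ; ·-mem = λ a v (v∈S , v∈T) → S.·-mem a v v∈S , T.·-mem a v v∈T
      }
      where
      module S = Subspace S
      module T = Subspace T

    ker : Vect F n → Subspace F n
    ker c = record
      { mem = λ v → dot c v ≡ 0#
      ; mem? = λ v → dot c v ≟ 0#
      ; zero-mem = dot-0ʳ c
      ; +-mem = λ u v c·u≡0 c·v≡0 →
          trans (dot-+ʳ c u v) (trans (cong₂ _+F_ c·u≡0 c·v≡0) (R.+-identityʳ 0#))
      ; ·-mem = λ a v c·v≡0 → trans (dot-·ʳ c a v) (trans (cong (a *F_) c·v≡0) (R.zeroʳ a))
      }

  -- Counting in subspaces

  module _ {n : ℕ} where
    open Subspace

    ∣_∣ : Subspace F n → ℕ
    ∣ S ∣ = ∑ λ v → 𝟙 (mem? S v)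

    translation : Vect F n → Vect F n ↔ Vect F n
    translation w = mk↔ₛ′ (_+ᵥ w) (_+ᵥ -ᵥ w) ([u-w]+w≡u w) ([u+w]-w≡u w)

    ∑-translate : ∀ (f : Vect F n → ℕ) w → ∑ (λ v → f (v +ᵥ w)) ≡ ∑ f
    ∑-translate f w = ∑-reindex (translation w) f

    𝟙-mem-+ : ∀ (S : Subspace F n) {t} → mem S t → ∀ v → 𝟙 (mem? S (v +ᵥ t)) ≡ 𝟙 (mem? S v)
    𝟙-mem-+ S {t} t∈S v =
      𝟙-cong (mem? S (v +ᵥ t)) (mem? S v) (+-mem⁻¹ˡ S t∈S) (λ v∈S → +-mem S v _ v∈S t∈S)

    ∣S∣≡q^dim : ∀ (S : Subspace F n) {m} → HasDim F n (mem S) m → ∣ S ∣ ≡ q ^ m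
    ∣S∣≡q^dim S {m} (b , b∈S , independent , spans) = begin
      ∑ (λ v → 𝟙 (mem? S v))                   ≡⟨ ∑-cong #preimages ⟩
      ∑ (λ v → ∑ λ w → 𝟙 (image w ≟ v))        ≡⟨ ∑-comm (λ v w → 𝟙 (image w ≟ v)) ⟩
      ∑ (λ w → ∑ λ v → 𝟙 (image w ≟ v))        ≡⟨ ∑-cong (∑-δ′ ∘ image) ⟩
      ∑ (λ (w : Vec Carrier m) → 1)             ≡⟨ ∑-const 1 ⟩
      q ^ m * 1                                 ≡⟨ *-identityʳ (q ^ m) ⟩
      q ^ m                                     ∎
      where
      open ≡-Reasoning
      image : Vec Carrier m → Vect F n
      image w = lincomb F n b (lookup w)
      #preimages : ∀ v → 𝟙 (mem? S v) ≡ ∑ λ w → 𝟙 (image w ≟ v)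
      #preimages v with mem? S v
      ... | no v∉S =
        sym (∑-zero λ w → 𝟙-no (image w ≟ v) λ eq → v∉S (subst (mem S) eq (lincomb-mem S b b∈S (lookup w))))
      ... | yes v∈S =
        sym (trans (∑-cong λ w → 𝟙-cong (image w ≟ v) (w ≟ tabulate c) to (from w)) (∑-δ (tabulate c)))
        where
        c : Fin m → Carrier
        c = proj₁ (spans v v∈S)
        c↦v : lincomb F n b c ≡ v
        c↦v = proj₂ (spans v v∈S)
        to : ∀ {w} → image w ≡ v → w ≡ tabulate c
        to {w} w↦v = trans (sym (Vec.tabulate∘lookup w))
                           (Vec.tabulate-cong (lincomb-injective b independent (trans w↦v (sym c↦v))))
        from : ∀ w → w ≡ tabulate c → image w ≡ v
        from _ refl = trans (lincomb-cong b (Vec.lookup∘tabulate c)) c↦v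

    fibre : Subspace F n → Vect F n → Carrier → ℕ
    fibre S c y = ∑ λ v → 𝟙 (mem? S v) * 𝟙 (dot c v ≟ y)

    fibre≡fibre₀ : ∀ S c {m₀} → mem S m₀ → dot c m₀ ≢ 0# → ∀ y → fibre S c y ≡ fibre S c 0#
    fibre≡fibre₀ S c {m₀} m₀∈S c·m₀≢0 y = begin
      fibre S c y                                              ≡⟨ ∑-translate _ w ⟨
      ∑ (λ v → 𝟙 (mem? S (v +ᵥ w)) * 𝟙 (dot c (v +ᵥ w) ≟ y))   ≡⟨ ∑-cong shifted ⟩
      fibre S c 0#                                             ∎
      where
      open ≡-Reasoning
      λ⁻¹ : Carrier
      λ⁻¹ = proj₁ (inverse (dot c m₀) c·m₀≢0)
      w : Vect F n
      w = (y *F λ⁻¹) ·ᵥ m₀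
      c·w≡y : dot c w ≡ y
      c·w≡y = begin
        dot c w                   ≡⟨ dot-·ʳ c (y *F λ⁻¹) m₀ ⟩
        (y *F λ⁻¹) *F dot c m₀    ≡⟨ R.*-assoc y λ⁻¹ (dot c m₀) ⟩
        y *F (λ⁻¹ *F dot c m₀)    ≡⟨ cong (y *F_) (trans (R.*-comm λ⁻¹ _) (proj₂ (inverse (dot c m₀) c·m₀≢0))) ⟩
        y *F 1#                   ≡⟨ R.*-identityʳ y ⟩
        y                         ∎
      c·[v+w]≡y⇔c·v≡0 : ∀ v → 𝟙 (dot c (v +ᵥ w) ≟ y) ≡ 𝟙 (dot c v ≟ 0#)
      c·[v+w]≡y⇔c·v≡0 v = 𝟙-cong (dot c (v +ᵥ w) ≟ y) (dot c v ≟ 0#)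
        (λ eq → RP.+-identityˡ-unique (dot c v) y
                  (trans (cong (dot c v +F_) (sym c·w≡y)) (trans (sym (dot-+ʳ c v w)) eq)))
        (λ eq → trans (dot-+ʳ c v w) (trans (cong₂ _+F_ eq c·w≡y) (R.+-identityˡ y)))
      shifted : ∀ v → 𝟙 (mem? S (v +ᵥ w)) * 𝟙 (dot c (v +ᵥ w) ≟ y) ≡ 𝟙 (mem? S v) * 𝟙 (dot c v ≟ 0#)
      shifted v = cong₂ _*_ (𝟙-mem-+ S (·-mem S _ m₀ m₀∈S) v) (c·[v+w]≡y⇔c·v≡0 v)

    q*fibre≡∣S∣ : ∀ S c {m₀} → mem S m₀ → dot c m₀ ≢ 0# → ∀ y → q * fibre S c y ≡ ∣ S ∣
    q*fibre≡∣S∣ S c m₀∈S c·m₀≢0 y = begin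
      q * fibre S c y                                    ≡⟨ cong (q *_) (fibre≡fibre₀ S c m₀∈S c·m₀≢0 y) ⟩
      q * fibre S c 0#                                   ≡⟨ ∑-const (fibre S c 0#) ⟨
      ∑ (λ y → fibre S c 0#)                             ≡⟨ ∑-cong (fibre≡fibre₀ S c m₀∈S c·m₀≢0) ⟨
      ∑ (λ y → ∑ λ v → 𝟙 (mem? S v) * 𝟙 (dot c v ≟ y))   ≡⟨ ∑-comm _ ⟩
      ∑ (λ v → ∑ λ y → 𝟙 (mem? S v) * 𝟙 (dot c v ≟ y))   ≡⟨ ∑-cong (λ v → ∑-*ˡ (𝟙 (mem? S v)) _) ⟩
      ∑ (λ v → 𝟙 (mem? S v) * ∑ λ y → 𝟙 (dot c v ≟ y))   ≡⟨ ∑-cong (λ v → cong (𝟙 (mem? S v) *_) (∑-δ′ (dot c v))) ⟩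
      ∑ (λ v → 𝟙 (mem? S v) * 1)                         ≡⟨ ∑-cong (λ v → *-identityʳ _) ⟩
      ∣ S ∣                                              ∎
      where
      open ≡-Reasoning

    ∣_∩[_-_]∣ : Subspace F n → Subspace F n → Vect F n → ℕ
    ∣ S ∩[ T - a ]∣ = ∑ λ v → 𝟙 (mem? S v) * 𝟙 (mem? T (v +ᵥ a))

    ∣S∩[T-a]∣≤∣S∩T∣ : ∀ S T a → ∣ S ∩[ T - a ]∣ ≤ ∣ S ∩ˢ T ∣
    ∣S∩[T-a]∣≤∣S∩T∣ S T a with ∃? (λ v → mem? S v ×-dec mem? T (v +ᵥ a))
    ... | no ∄ = subst (_≤ ∣ S ∩ˢ T ∣) (sym (∑-zero nowhere)) z≤n
      where
      nowhere : ∀ v → 𝟙 (mem? S v) * 𝟙 (mem? T (v +ᵥ a)) ≡ 0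
      nowhere v = trans (sym (𝟙-× (mem? S v) (mem? T (v +ᵥ a))))
                        (𝟙-no (mem? S v ×-dec mem? T (v +ᵥ a)) (∄ ∘ (v ,_)))
    ... | yes (s₀ , s₀∈S , s₀+a∈T) = ≤-reflexive (begin
      ∣ S ∩[ T - a ]∣                                              ≡⟨ ∑-translate _ s₀ ⟨
      ∑ (λ v → 𝟙 (mem? S (v +ᵥ s₀)) * 𝟙 (mem? T (v +ᵥ s₀ +ᵥ a)))   ≡⟨ ∑-cong shifted ⟩
      ∣ S ∩ˢ T ∣                                                   ∎)
      where
      open ≡-Reasoning
      shifted : ∀ v → 𝟙 (mem? S (v +ᵥ s₀)) * 𝟙 (mem? T (v +ᵥ s₀ +ᵥ a)) ≡ 𝟙 (mem? (S ∩ˢ T) v)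
      shifted v = begin
        𝟙 (mem? S (v +ᵥ s₀)) * 𝟙 (mem? T (v +ᵥ s₀ +ᵥ a))
          ≡⟨ cong (λ u → 𝟙 (mem? S (v +ᵥ s₀)) * 𝟙 (mem? T u)) (+ᵥ-assoc v s₀ a) ⟩
        𝟙 (mem? S (v +ᵥ s₀)) * 𝟙 (mem? T (v +ᵥ (s₀ +ᵥ a)))
          ≡⟨ cong₂ _*_ (𝟙-mem-+ S s₀∈S v) (𝟙-mem-+ T s₀+a∈T v) ⟩
        𝟙 (mem? S v) * 𝟙 (mem? T v)
          ≡⟨ 𝟙-× (mem? S v) (mem? T v) ⟨
        𝟙 (mem? (S ∩ˢ T) v) ∎

    ∑-∣S∩[T-a]∣≡∣S∣*∣T∣ : ∀ S T → ∑ (λ a → ∣ S ∩[ T - a ]∣) ≡ ∣ S ∣ * ∣ T ∣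
    ∑-∣S∩[T-a]∣≡∣S∣*∣T∣ S T = begin
      ∑ (λ a → ∑ λ v → 𝟙 (mem? S v) * 𝟙 (mem? T (v +ᵥ a)))   ≡⟨ ∑-comm _ ⟩
      ∑ (λ v → ∑ λ a → 𝟙 (mem? S v) * 𝟙 (mem? T (v +ᵥ a)))   ≡⟨ ∑-cong (λ v → ∑-*ˡ (𝟙 (mem? S v)) _) ⟩
      ∑ (λ v → 𝟙 (mem? S v) * ∑ λ a → 𝟙 (mem? T (v +ᵥ a)))   ≡⟨ ∑-cong (λ v → cong (𝟙 (mem? S v) *_) (translates v)) ⟩
      ∑ (λ v → 𝟙 (mem? S v) * ∣ T ∣)                         ≡⟨ ∑-*ʳ ∣ T ∣ _ ⟩
      ∣ S ∣ * ∣ T ∣                                           ∎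
      where
      open ≡-Reasoning
      translates : ∀ v → ∑ (λ a → 𝟙 (mem? T (v +ᵥ a))) ≡ ∣ T ∣
      translates v = trans (∑-cong λ a → cong (𝟙 ∘ mem? T) (+ᵥ-comm v a)) (∑-translate _ v)

    ∣S∩[T-a]∣≡∣S∩T∣ : ∀ S T → ∣ S ∣ * ∣ T ∣ ≡ q ^ n * ∣ S ∩ˢ T ∣ → ∀ a → ∣ S ∩[ T - a ]∣ ≡ ∣ S ∩ˢ T ∣
    ∣S∩[T-a]∣≡∣S∩T∣ S T ∣S∣∣T∣≡q^n∣S∩T∣ =
      ∑-tight (∣S∩[T-a]∣≤∣S∩T∣ S T) (trans (∑-∣S∩[T-a]∣≡∣S∣*∣T∣ S T) ∣S∣∣T∣≡q^n∣S∩T∣)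

    ∣⊤ˢ∣ : ∣ ⊤ˢ ∣ ≡ q ^ n
    ∣⊤ˢ∣ = trans (∑-const 1) (*-identityʳ (q ^ n))

    ∣ker0ᵥ∣ : ∣ ker 0ᵥ ∣ ≡ q ^ n
    ∣ker0ᵥ∣ = trans (∑-cong λ c → 𝟙-yes (dot 0ᵥ c ≟ 0#) (trans (dot-comm 0ᵥ c) (dot-0ʳ c))) ∣⊤ˢ∣

    q*∣ker∣≡q^n : ∀ v → v ≢ 0ᵥ → q * ∣ ker v ∣ ≡ q ^ n
    q*∣ker∣≡q^n v v≢0 = begin
      q * ∣ ker v ∣        ≡⟨ cong (q *_) (∑-cong λ c → *-identityˡ _) ⟨
      q * fibre ⊤ˢ v 0#    ≡⟨ q*fibre≡∣S∣ ⊤ˢ v tt v·c≢0 0# ⟩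
      ∣ ⊤ˢ ∣               ≡⟨ ∣⊤ˢ∣ ⟩
      q ^ n                ∎
      where
      open ≡-Reasoning
      v·c≢0 : dot v (proj₁ (≢0ᵥ⇒∃dot≡1 v v≢0)) ≢ 0#
      v·c≢0 v·c≡0 = 0≢1 (trans (sym v·c≡0) (proj₂ (≢0ᵥ⇒∃dot≡1 v v≢0)))

  module _ {n : ℕ} where
    open Subspace

    annihilates? : ∀ {m} (b : Fin m → Vect F n) c → Dec (∀ l → dot c (b l) ≡ 0#)
    annihilates? b c = Fin.all? λ l → dot c (b l) ≟ 0#

    -- Double count the pairs (c , v) with v ∈ M and c · v = 0: a functional annihilating M
    -- contributes ∣M∣ of them and any other one ∣M∣ / q, while v = 0 contributes q ^ n and any
    -- other v ∈ M contributes q ^ n / q.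
    module Annihilators (M : Subspace F n) {m} (dimM : HasDim F n (mem M) m) where

      private
        b : Fin m → Vect F n
        b = proj₁ dimM
        q′ : ℕ
        q′ = pred q
        q≡1+q′ : q ≡ suc q′
        q≡1+q′ = sym (suc-pred q {{>-nonZero (≤-trans (s≤s z≤n) 2≤q)}})

      #annihilators : ℕ
      #annihilators = ∑ λ c → 𝟙 (annihilates? b c)

      fibre₀≡∣M∣ : ∀ c → (∀ l → dot c (b l) ≡ 0#) → fibre M c 0# ≡ ∣ M ∣
      fibre₀≡∣M∣ c c⊥b = ∑-cong λ v → trans (𝟙*-cong (mem? M v) (c·v≡0 v)) (*-identityʳ _)
        where
        c·v≡0 : ∀ v → mem M v → 𝟙 (dot c v ≟ 0#) ≡ 1
        c·v≡0 v v∈M = 𝟙-yes (dot c v ≟ 0#)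
          (subst (mem (ker c)) (proj₂ (proj₂ (proj₂ (proj₂ dimM)) v v∈M)) (lincomb-mem (ker c) b c⊥b _))

      q*fibre₀≡∣M∣ : ∀ c → ¬ (∀ l → dot c (b l) ≡ 0#) → q * fibre M c 0# ≡ ∣ M ∣
      q*fibre₀≡∣M∣ c ¬c⊥b =
        let (l , c·bₗ≢0) = Fin.¬∀⟶∃¬ _ _ (λ l → dot c (b l) ≟ 0#) ¬c⊥b
        in q*fibre≡∣S∣ M c (proj₁ (proj₂ dimM) l) c·bₗ≢0 0#

      count-by-functionals : q * ∑ (λ c → fibre M c 0#) ≡ q ^ n * ∣ M ∣ + #annihilators * (q′ * ∣ M ∣)
      count-by-functionals = begin
        q * ∑ (λ c → fibre M c 0#)                                       ≡⟨ ∑-*ˡ q _ ⟨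
        ∑ (λ c → q * fibre M c 0#)                                       ≡⟨ ∑-cong per-functional ⟩
        ∑ (λ c → ∣ M ∣ + 𝟙 (annihilates? b c) * (q′ * ∣ M ∣))            ≡⟨ ∑-+ _ _ ⟩
        ∑ (λ c → ∣ M ∣) + ∑ (λ c → 𝟙 (annihilates? b c) * (q′ * ∣ M ∣))   ≡⟨ cong₂ _+_ (∑-const ∣ M ∣) (∑-*ʳ _ _) ⟩
        q ^ n * ∣ M ∣ + #annihilators * (q′ * ∣ M ∣)                      ∎
        where
        open ≡-Reasoning
        per-functional : ∀ c → q * fibre M c 0# ≡ ∣ M ∣ + 𝟙 (annihilates? b c) * (q′ * ∣ M ∣)
        per-functional c with annihilates? b c
        ... | yes c⊥b = begin
          q * fibre M c 0#           ≡⟨ cong₂ _*_ q≡1+q′ (fibre₀≡∣M∣ c c⊥b) ⟩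
          ∣ M ∣ + q′ * ∣ M ∣          ≡⟨ cong (∣ M ∣ +_) (*-identityˡ _) ⟨
          ∣ M ∣ + 1 * (q′ * ∣ M ∣)    ∎
        ... | no ¬c⊥b = trans (q*fibre₀≡∣M∣ c ¬c⊥b) (sym (+-identityʳ ∣ M ∣))

      count-by-vectors : q * ∑ (λ c → fibre M c 0#) ≡ ∣ M ∣ * q ^ n + q′ * q ^ n
      count-by-vectors = begin
        q * ∑ (λ c → fibre M c 0#)                                            ≡⟨ cong (q *_) (∑-comm _) ⟩
        q * ∑ (λ v → ∑ λ c → 𝟙 (mem? M v) * 𝟙 (dot c v ≟ 0#))                  ≡⟨ cong (q *_) (∑-cong pairs-at) ⟩
        q * ∑ (λ v → 𝟙 (mem? M v) * ∣ ker v ∣)                                 ≡⟨ ∑-*ˡ q _ ⟨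
        ∑ (λ v → q * (𝟙 (mem? M v) * ∣ ker v ∣))                               ≡⟨ ∑-cong per-vector ⟩
        ∑ (λ v → 𝟙 (mem? M v) * q ^ n + 𝟙 (v ≟ 0ᵥ) * (q′ * q ^ n))             ≡⟨ ∑-+ _ _ ⟩
        ∑ (λ v → 𝟙 (mem? M v) * q ^ n) + ∑ (λ v → 𝟙 (v ≟ 0ᵥ) * (q′ * q ^ n))   ≡⟨ cong₂ _+_ (∑-*ʳ _ _) (∑-δ-*ʳ 0ᵥ _) ⟩
        ∣ M ∣ * q ^ n + q′ * q ^ n                                             ∎
        where
        open ≡-Reasoning
        pairs-at : ∀ v → ∑ (λ c → 𝟙 (mem? M v) * 𝟙 (dot c v ≟ 0#)) ≡ 𝟙 (mem? M v) * ∣ ker v ∣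
        pairs-at v = trans (∑-*ˡ (𝟙 (mem? M v)) _) (cong (𝟙 (mem? M v) *_) (∑-cong λ c →
          𝟙-cong (dot c v ≟ 0#) (dot v c ≟ 0#) (trans (dot-comm v c)) (trans (dot-comm c v))))
        per-vector : ∀ v → q * (𝟙 (mem? M v) * ∣ ker v ∣) ≡ 𝟙 (mem? M v) * q ^ n + 𝟙 (v ≟ 0ᵥ) * (q′ * q ^ n)
        per-vector v with v ≟ 0ᵥ
        ... | yes refl rewrite 𝟙-yes (mem? M 0ᵥ) (zero-mem M) = begin
          q * (1 * ∣ ker 0ᵥ ∣)            ≡⟨ cong₂ (λ q x → q * (1 * x)) q≡1+q′ ∣ker0ᵥ∣ ⟩
          suc q′ * (1 * q ^ n)            ≡⟨ cong (1 * q ^ n +_) (x∙yz≈y∙xz q′ 1 (q ^ n)) ⟩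
          1 * q ^ n + 1 * (q′ * q ^ n)    ∎
        ... | no v≢0 = begin
          q * (𝟙 (mem? M v) * ∣ ker v ∣)     ≡⟨ x∙yz≈y∙xz q (𝟙 (mem? M v)) ∣ ker v ∣ ⟩
          𝟙 (mem? M v) * (q * ∣ ker v ∣)     ≡⟨ cong (𝟙 (mem? M v) *_) (q*∣ker∣≡q^n v v≢0) ⟩
          𝟙 (mem? M v) * q ^ n               ≡⟨ +-identityʳ _ ⟨
          𝟙 (mem? M v) * q ^ n + 0           ∎

      #annihilators*∣M∣≡q^n : #annihilators * ∣ M ∣ ≡ q ^ n
      #annihilators*∣M∣≡q^n = *-cancelˡ-≡ _ _ q′ {{q′-nonZero}} (+-cancelˡ-≡ (q ^ n * ∣ M ∣) _ _ (begin
        q ^ n * ∣ M ∣ + q′ * (#annihilators * ∣ M ∣)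
          ≡⟨ cong (q ^ n * ∣ M ∣ +_) (x∙yz≈y∙xz q′ #annihilators ∣ M ∣) ⟩
        q ^ n * ∣ M ∣ + #annihilators * (q′ * ∣ M ∣)
          ≡⟨ count-by-functionals ⟨
        q * ∑ (λ c → fibre M c 0#)
          ≡⟨ count-by-vectors ⟩
        ∣ M ∣ * q ^ n + q′ * q ^ n
          ≡⟨ cong (_+ q′ * q ^ n) (*-comm ∣ M ∣ (q ^ n)) ⟩
        q ^ n * ∣ M ∣ + q′ * q ^ n ∎))
        where
        open ≡-Reasoning
        q′-nonZero : NonZero q′
        q′-nonZero = >-nonZero (≤-pred (subst (2 ≤_) q≡1+q′ 2≤q))

    count≡∑ : ∀ {s} (M : Fin s → Subspace F n) v → count F n M v ≡ ∑ λ i → 𝟙 (mem? (M i) v)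
    count≡∑ {zero} M v = sym (∑-zero λ ())
    count≡∑ {suc s} M v =
      trans (cong₂ _+_ (if-does (mem? (M zero) v)) (count≡∑ (M ∘ suc) v)) (sym (∑-Fin-suc _))
      where
      if-does : ∀ {P : Set} (P? : Dec P) → (if does P? then 1 else 0) ≡ 𝟙 P?
      if-does (yes _) = refl
      if-does (no _) = refl

-- Arithmetic

m∣m^n : ∀ {m n} → 1 ≤ n → m ∣ m ^ n
m∣m^n {m} {suc n} _ = m∣m*n (m ^ n)

module _ {p : ℕ} (p-prime : Prime p) where

  private instance
    p-nonZero : NonZero p
    p-nonZero = prime⇒nonZero p-prime

  ∣p^⇒≡p^ : ∀ e {d} → d ∣ p ^ e → ∃ λ α → d ≡ p ^ α
  ∣p^⇒≡p^ zero d∣1 = 0 , ∣1⇒≡1 d∣1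
  ∣p^⇒≡p^ (suc e) {d} d∣p^[1+e] with p ∣? d
  ... | no p∤d = ∣p^⇒≡p^ e (coprime-divisor d⊥p d∣p^[1+e])
    where
    d⊥p : Coprime d p
    d⊥p (i∣d , i∣p) with prime⇒irreducible p-prime i∣p
    ... | inj₁ i≡1 = i≡1
    ... | inj₂ refl = contradiction i∣d p∤d
  ... | yes (divides d′ refl) =
    let (α , d′≡p^α) = ∣p^⇒≡p^ e {d′} (*-cancelʳ-∣ p (subst (d′ * p ∣_) (*-comm p (p ^ e)) d∣p^[1+e]))
    in suc α , trans (cong (_* p) d′≡p^α) (*-comm (p ^ α) p)

  -- If α > e then p ∣ x, as p ^ α ∣ x * p ^ e; reducing p ^ α * b ≡ b + x * a modulo p then gives
  -- p ∣ b, against p ∣ b + 1.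
  p^-exponent-bound : ∀ {α e x a b} → p ^ α ∣ x * p ^ e → p ∣ suc b → p ^ α * b ≡ b + x * a → α ≤ e
  p^-exponent-bound {α} {e} {x} {a} {b} p^α∣x*p^e p∣b+1 p^α*b≡b+x*a with α ≤? e
  ... | yes α≤e = α≤e
  ... | no α≰e = contradiction (∣1⇒≡1 p∣1) (λ p≡1 → ¬prime[1] (subst Prime p≡1 p-prime))
    where
    δ : ℕ
    δ = proj₁ (m≤n⇒∃[o]m+o≡n (≰⇒> α≰e))
    α≡1+δ+e : α ≡ suc δ + e
    α≡1+δ+e = trans (sym (proj₂ (m≤n⇒∃[o]m+o≡n (≰⇒> α≰e)))) (cong suc (+-comm e δ))
    p∣x : p ∣ x
    p∣x = ∣-trans (m∣m*n (p ^ δ)) (*-cancelʳ-∣ (p ^ e) {{m^n≢0 p e}}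
            (subst (_∣ x * p ^ e) (trans (cong (p ^_) α≡1+δ+e) (^-distribˡ-+-* p (suc δ) e)) p^α∣x*p^e))
    p∣p^α : p ∣ p ^ α
    p∣p^α = subst (λ α → p ∣ p ^ α) (sym α≡1+δ+e) (m∣m*n (p ^ (δ + e)))
    p∣b : p ∣ b
    p∣b = ∣m+n∣m⇒∣n (subst (p ∣_) (trans p^α*b≡b+x*a (+-comm b (x * a))) (∣m⇒∣m*n b p∣p^α)) (∣m⇒∣m*n a p∣x)
    p∣1 : p ∣ 1
    p∣1 = ∣m+n∣m⇒∣n (subst (p ∣_) (+-comm 1 b) p∣b+1) p∣b

-- With D = (1 + a)(1 + m)² + a, the left side of (1 + m) · h₁ + D · h₂ exceeds its right side
-- by 1 + E for the polynomial E appearing in certificate.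
polynomial-bounds-incompatible : ∀ a m x →
  let b = 1 + m + 2 * a + a * m
      ν = 3 + 4 * m + m * m + 4 * a + 4 * a * m + a * m * m
  in suc x * b * b + (b + x * a) ≤ (b + x * a) * ν → ν ≤ suc x * suc m → ⊥
polynomial-bounds-incompatible a m x h₁ h₂ =
  m+1+n≰m R (subst (_≤ R) (certificate a m x) (+-mono-≤ (*-monoʳ-≤ (suc m) h₁) (*-monoʳ-≤ D h₂)))
  where
  D R : ℕ
  D = 1 + 2 * m + m * m + 2 * a + 2 * a * m + a * m * m
  R = suc m * (((1 + m + 2 * a + a * m) + x * a) * (3 + 4 * m + m * m + 4 * a + 4 * a * m + a * m * m))
      + D * (suc x * suc m)
  certificate : ∀ a m x →
    suc m * (suc x * (1 + m + 2 * a + a * m) * (1 + m + 2 * a + a * m) + ((1 + m + 2 * a + a * m) + x * a))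
      + (1 + 2 * m + m * m + 2 * a + 2 * a * m + a * m * m) * (3 + 4 * m + m * m + 4 * a + 4 * a * m + a * m * m)
    ≡ suc m * (((1 + m + 2 * a + a * m) + x * a) * (3 + 4 * m + m * m + 4 * a + 4 * a * m + a * m * m))
      + (1 + 2 * m + m * m + 2 * a + 2 * a * m + a * m * m) * (suc x * suc m)
      + suc (2 * m + m * m + 4 * a + 6 * a * m + 2 * a * m * m + 4 * a * a + 4 * a * a * m + a * a * m * m)
  certificate = solve-∀

-- Eliminating d between the two relations involving it bounds x from above; the last hypothesis
-- bounds x from below.
counting-bounds-incompatible : ∀ a m x d b ν → suc b ≡ suc a * (2 + m) → suc ν ≡ suc b * (2 + m) →
                               d * b ≡ b + x * a → suc x * b + d ≤ d * ν → ν + suc x ≤ suc x * (2 + m) → ⊥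
counting-bounds-incompatible a m x d b ν B≡AK N≡BK d*b≡b+x*a total≤ covered =
  polynomial-bounds-incompatible a m x
    (subst₂ (λ b ν → suc x * b * b + (b + x * a) ≤ (b + x * a) * ν) b≡B′ ν≡N′ h₁)
    (subst (_≤ suc x * suc m) ν≡N′ h₂)
  where
  b≡B′ : b ≡ 1 + m + 2 * a + a * m
  b≡B′ = suc-injective (trans B≡AK (lemma a m))
    where
    lemma : ∀ a m → suc a * (2 + m) ≡ suc (1 + m + 2 * a + a * m)
    lemma = solve-∀
  ν≡N′ : ν ≡ 3 + 4 * m + m * m + 4 * a + 4 * a * m + a * m * m
  ν≡N′ = suc-injective (trans N≡BK (trans (cong (λ b → suc b * (2 + m)) b≡B′) (lemma a m)))
    where
    lemma : ∀ a m → suc (1 + m + 2 * a + a * m) * (2 + m) ≡ suc (3 + 4 * m + m * m + 4 * a + 4 * a * m + a * m * m)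
    lemma = solve-∀
  h₁ : suc x * b * b + (b + x * a) ≤ (b + x * a) * ν
  h₁ = subst₂ _≤_ (trans (*-distribʳ-+ b (suc x * b) d) (cong (suc x * b * b +_) d*b≡b+x*a)) d*ν*b≡[b+x*a]*ν
                  (*-monoˡ-≤ b total≤)
    where
    d*ν*b≡[b+x*a]*ν : d * ν * b ≡ (b + x * a) * ν
    d*ν*b≡[b+x*a]*ν = trans (*-assoc d ν b) (trans (cong (d *_) (*-comm ν b))
                        (trans (sym (*-assoc d b ν)) (cong (_* ν) d*b≡b+x*a)))
  h₂ : ν ≤ suc x * suc m
  h₂ = +-cancelʳ-≤ (suc x) ν (suc x * suc m) (subst (ν + suc x ≤_) (lemma x m) covered)
    where
    lemma : ∀ x m → suc x * (2 + m) ≡ suc x * suc m + suc x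
    lemma = solve-∀

module Configuration
  {q : ℕ} (F : FiniteField q) (n k s′ d : ℕ) (k≥1 : 1 ≤ k) (2k≤n : 2 * k ≤ n)
  (M : Fin (suc s′) → Subspace F n)
  (dimM : ∀ i → HasDim F n (Subspace.mem (M i)) (n ∸ k))
  (mult∈0,d : ∀ v → v ≢ 0v F n → count F n M v ≡ 0 ⊎ count F n M v ≡ d)
  (a₀ : Vect F n) (a₀≢0 : a₀ ≢ 0v F n) (mult-a₀ : count F n M a₀ ≡ 0)
  (dimM∩M : ∀ i j → i ≢ j → HasDim F n (λ v → Subspace.mem (M i) v × Subspace.mem (M j) v) (n ∸ 2 * k))
  where

  open FiniteField F
  open Subspace
  open VectorSpace F

  instance
    q-nonZero : NonZero q
    q-nonZero = >-nonZero (≤-trans (s≤s z≤n) 2≤q)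

  A B K N : ℕ
  A = q ^ (n ∸ 2 * k)
  B = q ^ (n ∸ k)
  K = q ^ k
  N = q ^ n

  B≡A*K : B ≡ A * K
  B≡A*K = trans (cong (q ^_) n∸k≡[n∸2k]+k) (^-distribˡ-+-* q (n ∸ 2 * k) k)
    where
    n∸k≡[n∸2k]+k : n ∸ k ≡ n ∸ 2 * k + k
    n∸k≡[n∸2k]+k = begin
      n ∸ k                 ≡⟨ cong (_∸ k) (trans (sym 2k+r≡n) (lemma k r)) ⟩
      k + (r + k) ∸ k       ≡⟨ m+n∸m≡n k (r + k) ⟩
      r + k                 ≡⟨ cong (_+ k) (m+n∸m≡n (2 * k) r) ⟨
      2 * k + r ∸ 2 * k + k ≡⟨ cong (λ n → n ∸ 2 * k + k) 2k+r≡n ⟩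
      n ∸ 2 * k + k         ∎
      where
      open ≡-Reasoning
      r : ℕ
      r = proj₁ (m≤n⇒∃[o]m+o≡n 2k≤n)
      2k+r≡n : 2 * k + r ≡ n
      2k+r≡n = proj₂ (m≤n⇒∃[o]m+o≡n 2k≤n)
      lemma : ∀ k r → 2 * k + r ≡ k + (r + k)
      lemma = solve-∀

  N≡B*K : N ≡ B * K
  N≡B*K = trans (cong (q ^_) (sym (m∸n+n≡m k≤n))) (^-distribˡ-+-* q (n ∸ k) k)
    where
    k≤n : k ≤ n
    k≤n = ≤-trans (m≤m+n k (k + 0)) 2k≤n

  q∣B : q ∣ B
  q∣B = subst (q ∣_) (sym B≡A*K) (∣n⇒∣m*n A (m∣m^n k≥1))

  2≤K : 2 ≤ K
  2≤K = ≤-trans 2≤q (subst (_≤ K) (*-identityʳ q) (^-monoʳ-≤ q k≥1))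

  ∣Mᵢ∣≡B : ∀ i → ∣ M i ∣ ≡ B
  ∣Mᵢ∣≡B i = ∣S∣≡q^dim (M i) (dimM i)

  ∣Mᵢ∩Mⱼ∣≡A : ∀ i j → i ≢ j → ∣ M i ∩ˢ M j ∣ ≡ A
  ∣Mᵢ∩Mⱼ∣≡A i j i≢j = ∣S∣≡q^dim (M i ∩ˢ M j) (dimM∩M i j i≢j)

  mult : Vect F n → ℕ
  mult = count F n M

  mult-0ᵥ : mult 0ᵥ ≡ suc s′
  mult-0ᵥ = trans (count≡∑ M 0ᵥ) (trans (∑-cong λ i → 𝟙-yes (mem? (M i) 0ᵥ) (zero-mem (M i)))
                                        (trans (∑-const 1) (*-identityʳ (suc s′))))

  1≤mult : ∀ i {v} → mem (M i) v → 1 ≤ mult v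
  1≤mult i {v} v∈Mᵢ = subst₂ _≤_ (𝟙-yes (mem? (M i) v) v∈Mᵢ) (sym (count≡∑ M v)) (term≤∑ (λ i → 𝟙 (mem? (M i) v)) i)

  mult≡d : ∀ i {v} → v ≢ 0ᵥ → mem (M i) v → mult v ≡ d
  mult≡d i {v} v≢0 v∈Mᵢ with mult∈0,d v v≢0
  ... | inj₁ mult≡0 = contradiction (subst (1 ≤_) mult≡0 (1≤mult i v∈Mᵢ)) λ ()
  ... | inj₂ mult≡d = mult≡d

  mult≤d : ∀ {v} → v ≢ 0ᵥ → mult v ≤ d
  mult≤d {v} v≢0 with mult∈0,d v v≢0
  ... | inj₁ mult≡0 = subst (_≤ d) (sym mult≡0) z≤n
  ... | inj₂ mult≡d = ≤-reflexive mult≡d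

  d∣mult : ∀ {v} → v ≢ 0ᵥ → d ∣ mult v
  d∣mult {v} v≢0 with mult∈0,d v v≢0
  ... | inj₁ mult≡0 = subst (d ∣_) (sym mult≡0) (d ∣0)
  ... | inj₂ mult≡d = subst (d ∣_) (sym mult≡d) ∣-refl

  ∑-weighted-mult : ∀ (g : Vect F n → ℕ) → ∑ (λ v → g v * mult v) ≡ ∑ λ i → ∑ λ v → g v * 𝟙 (mem? (M i) v)
  ∑-weighted-mult g = begin
    ∑ (λ v → g v * mult v)                              ≡⟨ ∑-cong (λ v → cong (g v *_) (count≡∑ M v)) ⟩
    ∑ (λ v → g v * ∑ λ i → 𝟙 (mem? (M i) v))            ≡⟨ ∑-cong (λ v → ∑-*ˡ (g v) _) ⟨
    ∑ (λ v → ∑ λ i → g v * 𝟙 (mem? (M i) v))            ≡⟨ ∑-comm _ ⟩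
    ∑ (λ i → ∑ λ v → g v * 𝟙 (mem? (M i) v))            ∎
    where open ≡-Reasoning

  M₀ : Subspace F n
  M₀ = M zero

  a b ν : ℕ
  a = pred A
  b = pred B
  ν = pred N

  A≡1+a : A ≡ suc a
  A≡1+a = sym (suc-pred A {{m^n≢0 q (n ∸ 2 * k)}})

  B≡1+b : B ≡ suc b
  B≡1+b = sym (suc-pred B {{m^n≢0 q (n ∸ k)}})

  N≡1+ν : N ≡ suc ν
  N≡1+ν = sym (suc-pred N {{m^n≢0 q n}})

  ∑-M₀-mult≡B+s′*A : ∑ (λ v → 𝟙 (mem? M₀ v) * mult v) ≡ B + s′ * A
  ∑-M₀-mult≡B+s′*A = begin
    ∑ (λ v → 𝟙 (mem? M₀ v) * mult v)
      ≡⟨ ∑-weighted-mult (𝟙 ∘ mem? M₀) ⟩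
    ∑ (λ i → ∑ λ v → 𝟙 (mem? M₀ v) * 𝟙 (mem? (M i) v))
      ≡⟨ ∑-Fin-suc _ ⟩
    ∑ (λ v → 𝟙 (mem? M₀ v) * 𝟙 (mem? M₀ v)) + ∑ (λ j → ∑ λ v → 𝟙 (mem? M₀ v) * 𝟙 (mem? (M (suc j)) v))
      ≡⟨ cong₂ _+_ (∑-cong (𝟙-idem ∘ mem? M₀)) (∑-cong λ j → ∑-cong λ v → sym (𝟙-× (mem? M₀ v) _)) ⟩
    ∣ M₀ ∣ + ∑ (λ j → ∣ M₀ ∩ˢ M (suc j) ∣)
      ≡⟨ cong₂ _+_ (∣Mᵢ∣≡B zero) (∑-cong λ j → ∣Mᵢ∩Mⱼ∣≡A zero (suc j) λ ()) ⟩
    B + ∑ (λ (j : Fin s′) → A)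
      ≡⟨ cong (B +_) (∑-const A) ⟩
    B + s′ * A ∎
    where open ≡-Reasoning

  ∑-M₀-mult+d≡B*d+s : ∑ (λ v → 𝟙 (mem? M₀ v) * mult v) + d ≡ B * d + suc s′
  ∑-M₀-mult+d≡B*d+s = begin
    ∑ (λ v → 𝟙 (mem? M₀ v) * mult v) + d
      ≡⟨ cong (∑ (λ v → 𝟙 (mem? M₀ v) * mult v) +_) (∑-δ-*ʳ 0ᵥ d) ⟨
    ∑ (λ v → 𝟙 (mem? M₀ v) * mult v) + ∑ (λ v → 𝟙 (v ≟ 0ᵥ) * d)
      ≡⟨ ∑-+ _ _ ⟨
    ∑ (λ v → 𝟙 (mem? M₀ v) * mult v + 𝟙 (v ≟ 0ᵥ) * d)
      ≡⟨ ∑-cong pointwise ⟩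
    ∑ (λ v → 𝟙 (mem? M₀ v) * d + 𝟙 (v ≟ 0ᵥ) * suc s′)
      ≡⟨ ∑-+ _ _ ⟩
    ∑ (λ v → 𝟙 (mem? M₀ v) * d) + ∑ (λ v → 𝟙 (v ≟ 0ᵥ) * suc s′)
      ≡⟨ cong₂ _+_ (trans (∑-*ʳ d _) (cong (_* d) (∣Mᵢ∣≡B zero))) (∑-δ-*ʳ 0ᵥ (suc s′)) ⟩
    B * d + suc s′ ∎
    where
    open ≡-Reasoning
    pointwise : ∀ v → 𝟙 (mem? M₀ v) * mult v + 𝟙 (v ≟ 0ᵥ) * d ≡ 𝟙 (mem? M₀ v) * d + 𝟙 (v ≟ 0ᵥ) * suc s′
    pointwise v with v ≟ 0ᵥ
    ... | yes refl rewrite 𝟙-yes (mem? M₀ 0ᵥ) (zero-mem M₀) | mult-0ᵥ = +-comm (1 * suc s′) (1 * d)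
    ... | no v≢0 = cong (_+ 0) (𝟙*-cong (mem? M₀ v) (mult≡d zero v≢0))

  d*b≡b+s′*a : d * b ≡ b + s′ * a
  d*b≡b+s′*a = +-cancelˡ-≡ (suc s′ + d) _ _ (begin
    suc s′ + d + d * b                   ≡⟨ lemma₁ s′ d b ⟩
    suc b * d + suc s′                   ≡⟨ cong (λ B → B * d + suc s′) B≡1+b ⟨
    B * d + suc s′                       ≡⟨ ∑-M₀-mult+d≡B*d+s ⟨
    ∑ (λ v → 𝟙 (mem? M₀ v) * mult v) + d ≡⟨ cong (_+ d) ∑-M₀-mult≡B+s′*A ⟩
    B + s′ * A + d                       ≡⟨ cong₂ (λ B A → B + s′ * A + d) B≡1+b A≡1+a ⟩
    suc b + s′ * suc a + d               ≡⟨ lemma₂ s′ d b a ⟩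
    suc s′ + d + (b + s′ * a)            ∎)
    where
    open ≡-Reasoning
    lemma₁ : ∀ s′ d b → suc s′ + d + d * b ≡ suc b * d + suc s′
    lemma₁ = solve-∀
    lemma₂ : ∀ s′ d b a → suc b + s′ * suc a + d ≡ suc s′ + d + (b + s′ * a)
    lemma₂ = solve-∀

  ∑-mult≡s*B : ∑ mult ≡ suc s′ * B
  ∑-mult≡s*B = begin
    ∑ mult                                             ≡⟨ ∑-cong (λ v → *-identityˡ (mult v)) ⟨
    ∑ (λ v → 1 * mult v)                               ≡⟨ ∑-weighted-mult (λ _ → 1) ⟩
    ∑ (λ i → ∑ λ v → 1 * 𝟙 (mem? (M i) v))             ≡⟨ ∑-cong (λ i → trans (∑-cong λ v → *-identityˡ _) (∣Mᵢ∣≡B i)) ⟩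
    ∑ (λ (i : Fin (suc s′)) → B)                       ≡⟨ ∑-const B ⟩
    suc s′ * B                                         ∎
    where open ≡-Reasoning

  ∑-mult+2d≤s+N*d : ∑ mult + d + d ≤ suc s′ + N * d
  ∑-mult+2d≤s+N*d = begin
    ∑ mult + d + d
      ≡⟨ cong₂ _+_ (cong (∑ mult +_) (∑-δ-*ʳ a₀ d)) (∑-δ-*ʳ 0ᵥ d) ⟨
    ∑ mult + ∑ (λ v → 𝟙 (v ≟ a₀) * d) + ∑ (λ v → 𝟙 (v ≟ 0ᵥ) * d)
      ≡⟨ cong (_+ ∑ (λ v → 𝟙 (v ≟ 0ᵥ) * d)) (∑-+ _ _) ⟨
    ∑ (λ v → mult v + 𝟙 (v ≟ a₀) * d) + ∑ (λ v → 𝟙 (v ≟ 0ᵥ) * d)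
      ≡⟨ ∑-+ _ _ ⟨
    ∑ (λ v → mult v + 𝟙 (v ≟ a₀) * d + 𝟙 (v ≟ 0ᵥ) * d)
      ≤⟨ ∑-mono-≤ pointwise ⟩
    ∑ (λ v → 𝟙 (v ≟ 0ᵥ) * suc s′ + d)
      ≡⟨ ∑-+ _ _ ⟩
    ∑ (λ v → 𝟙 (v ≟ 0ᵥ) * suc s′) + ∑ (λ v → d)
      ≡⟨ cong₂ _+_ (∑-δ-*ʳ 0ᵥ (suc s′)) (∑-const d) ⟩
    suc s′ + N * d ∎
    where
    open ≤-Reasoning
    pointwise : ∀ v → mult v + 𝟙 (v ≟ a₀) * d + 𝟙 (v ≟ 0ᵥ) * d ≤ 𝟙 (v ≟ 0ᵥ) * suc s′ + d
    pointwise v with v ≟ 0ᵥ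
    ... | yes refl rewrite 𝟙-no (0ᵥ ≟ a₀) (a₀≢0 ∘ sym) | mult-0ᵥ = ≤-reflexive (lemma s′ d)
      where
      lemma : ∀ s′ d → suc s′ + 0 + 1 * d ≡ 1 * suc s′ + d
      lemma = solve-∀
    ... | no v≢0 with v ≟ a₀
    ...   | yes refl rewrite mult-a₀ = ≤-reflexive (trans (+-identityʳ _) (*-identityˡ d))
    ...   | no _ = ≤-trans (≤-reflexive (trans (+-identityʳ _) (+-identityʳ _))) (mult≤d v≢0)

  s*b+d≤d*ν : suc s′ * b + d ≤ d * ν
  s*b+d≤d*ν = +-cancelˡ-≤ (suc s′ + d) _ _ (begin
    suc s′ + d + (suc s′ * b + d)       ≡⟨ lemma₁ s′ d b ⟩
    suc s′ * suc b + d + d              ≡⟨ cong (λ B → suc s′ * B + d + d) B≡1+b ⟨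
    suc s′ * B + d + d                  ≡⟨ cong (λ m → m + d + d) ∑-mult≡s*B ⟨
    ∑ mult + d + d                      ≤⟨ ∑-mult+2d≤s+N*d ⟩
    suc s′ + N * d                      ≡⟨ cong (λ N → suc s′ + N * d) N≡1+ν ⟩
    suc s′ + suc ν * d                  ≡⟨ lemma₂ s′ d ν ⟩
    suc s′ + d + d * ν                  ∎)
    where
    open ≤-Reasoning
    lemma₁ : ∀ s′ d b → suc s′ + d + (suc s′ * b + d) ≡ suc s′ * suc b + d + d
    lemma₁ = solve-∀
    lemma₂ : ∀ s′ d ν → suc s′ + suc ν * d ≡ suc s′ + d + d * ν
    lemma₂ = solve-∀

  a₀∉M₀ : ¬ mem M₀ a₀
  a₀∉M₀ a₀∈M₀ = contradiction (subst (1 ≤_) mult-a₀ (1≤mult zero a₀∈M₀)) λ ()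

  B*B≡N*A : B * B ≡ N * A
  B*B≡N*A = begin
    B * B         ≡⟨ cong (B *_) B≡A*K ⟩
    B * (A * K)   ≡⟨ cong (B *_) (*-comm A K) ⟩
    B * (K * A)   ≡⟨ *-assoc B K A ⟨
    B * K * A     ≡⟨ cong (_* A) N≡B*K ⟨
    N * A         ∎
    where open ≡-Reasoning

  -- Every Mⱼ with j ≠ 0 meets the coset M₀ - a₀ in ∣M₀ ∩ Mⱼ∣ points, as ∣M₀∣ ∣Mⱼ∣ = ∣M₀ ∩ Mⱼ∣ ∣V∣.
  ∑-coset-mult≡s′*A : ∑ (λ v → 𝟙 (mem? M₀ (v +ᵥ a₀)) * mult v) ≡ s′ * A
  ∑-coset-mult≡s′*A = begin
    ∑ (λ v → in-coset v * mult v)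
      ≡⟨ ∑-weighted-mult in-coset ⟩
    ∑ (λ i → ∑ λ v → in-coset v * 𝟙 (mem? (M i) v))
      ≡⟨ ∑-Fin-suc _ ⟩
    ∑ (λ v → in-coset v * 𝟙 (mem? M₀ v)) + ∑ (λ j → ∑ λ v → in-coset v * 𝟙 (mem? (M (suc j)) v))
      ≡⟨ cong₂ _+_ (∑-zero misses-M₀) (∑-cong meets-Mⱼ) ⟩
    0 + ∑ (λ (j : Fin s′) → A)
      ≡⟨ ∑-const A ⟩
    s′ * A ∎
    where
    open ≡-Reasoning
    in-coset : Vect F n → ℕ
    in-coset v = 𝟙 (mem? M₀ (v +ᵥ a₀))
    misses-M₀ : ∀ v → in-coset v * 𝟙 (mem? M₀ v) ≡ 0
    misses-M₀ v = trans (sym (𝟙-× (mem? M₀ (v +ᵥ a₀)) (mem? M₀ v)))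
      (𝟙-no (mem? M₀ (v +ᵥ a₀) ×-dec mem? M₀ v) λ (v+a₀∈M₀ , v∈M₀) → a₀∉M₀ (+-mem⁻¹ʳ M₀ v∈M₀ v+a₀∈M₀))
    meets-Mⱼ : ∀ j → ∑ (λ v → in-coset v * 𝟙 (mem? (M (suc j)) v)) ≡ A
    meets-Mⱼ j = begin
      ∑ (λ v → in-coset v * 𝟙 (mem? (M (suc j)) v))   ≡⟨ ∑-cong (λ v → *-comm (in-coset v) _) ⟩
      ∑ (λ v → 𝟙 (mem? (M (suc j)) v) * in-coset v)   ≡⟨ ∣S∩[T-a]∣≡∣S∩T∣ (M (suc j)) M₀ ∣Mⱼ∣∣M₀∣≡N∣Mⱼ∩M₀∣ a₀ ⟩
      ∣ M (suc j) ∩ˢ M₀ ∣                             ≡⟨ ∣Mᵢ∩Mⱼ∣≡A (suc j) zero (λ ()) ⟩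
      A                                               ∎
      where
      ∣Mⱼ∣∣M₀∣≡N∣Mⱼ∩M₀∣ : ∣ M (suc j) ∣ * ∣ M₀ ∣ ≡ N * ∣ M (suc j) ∩ˢ M₀ ∣
      ∣Mⱼ∣∣M₀∣≡N∣Mⱼ∩M₀∣ = trans (cong₂ _*_ (∣Mᵢ∣≡B (suc j)) (∣Mᵢ∣≡B zero))
                                (trans B*B≡N*A (cong (N *_) (sym (∣Mᵢ∩Mⱼ∣≡A (suc j) zero λ ()))))

  d∣s′*A : d ∣ s′ * A
  d∣s′*A = subst (d ∣_) ∑-coset-mult≡s′*A (∣-∑ pointwise)
    where
    pointwise : ∀ v → d ∣ 𝟙 (mem? M₀ (v +ᵥ a₀)) * mult v
    pointwise v with mem? M₀ (v +ᵥ a₀)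
    ... | no _ = d ∣0
    ... | yes v+a₀∈M₀ = subst (d ∣_) (sym (+-identityʳ _)) (d∣mult v≢0)
      where
      v≢0 : v ≢ 0ᵥ
      v≢0 refl = a₀∉M₀ (+-mem⁻¹ʳ M₀ (zero-mem M₀) v+a₀∈M₀)

  basis : Fin (suc s′) → Fin (n ∸ k) → Vect F n
  basis i = proj₁ (dimM i)

  #annihilators≡K : ∀ i → ∑ (λ c → 𝟙 (annihilates? (basis i) c)) ≡ K
  #annihilators≡K i = *-cancelʳ-≡ _ K B {{m^n≢0 q (n ∸ k)}} (begin
    #annihilators * B                    ≡⟨ cong (#annihilators *_) (∣Mᵢ∣≡B i) ⟨
    #annihilators * ∣ M i ∣              ≡⟨ #annihilators*∣M∣≡q^n ⟩
    N                                    ≡⟨ N≡B*K ⟩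
    B * K                                ≡⟨ *-comm B K ⟩
    K * B                                ∎)
    where
    open ≡-Reasoning
    open Annihilators (M i) (dimM i)

  annihilates-none? : ∀ c → Dec (∀ i → ¬ (∀ l → dot c (basis i l) ≡ 0#))
  annihilates-none? c = Fin.all? λ i → ¬? (annihilates? (basis i) c)

  -- Count the pairs (c , i) with c annihilating Mᵢ: c = 0 annihilates all of them, and by
  -- assumption every other c at least one.
  N+s′≤s*K : ¬ (∃ λ c → ∀ i → ¬ (∀ l → dot c (basis i l) ≡ 0#)) → N + s′ ≤ suc s′ * K
  N+s′≤s*K none = begin
    N + s′                                            ≡⟨ cong₂ _+_ (*-identityʳ N) (∑-δ-*ʳ 0ᵥ s′) ⟨
    N * 1 + ∑ (λ c → 𝟙 (c ≟ 0ᵥ) * s′)                 ≡⟨ cong (_+ ∑ (λ c → 𝟙 (c ≟ 0ᵥ) * s′)) (∑-const 1) ⟨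
    ∑ (λ c → 1) + ∑ (λ c → 𝟙 (c ≟ 0ᵥ) * s′)           ≡⟨ ∑-+ _ _ ⟨
    ∑ (λ c → 1 + 𝟙 (c ≟ 0ᵥ) * s′)                     ≤⟨ ∑-mono-≤ pointwise ⟩
    ∑ #annihilated                                    ≡⟨ ∑-comm _ ⟩
    ∑ (λ i → ∑ λ c → 𝟙 (annihilates? (basis i) c))    ≡⟨ ∑-cong #annihilators≡K ⟩
    ∑ (λ (i : Fin (suc s′)) → K)                       ≡⟨ ∑-const K ⟩
    suc s′ * K                                        ∎
    where
    open ≤-Reasoning
    #annihilated : Vect F n → ℕ
    #annihilated c = ∑ λ i → 𝟙 (annihilates? (basis i) c)
    0ᵥ-annihilates : ∀ i l → dot 0ᵥ (basis i l) ≡ 0#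
    0ᵥ-annihilates i l = trans (dot-comm 0ᵥ (basis i l)) (dot-0ʳ (basis i l))
    pointwise : ∀ c → 1 + 𝟙 (c ≟ 0ᵥ) * s′ ≤ #annihilated c
    pointwise c with c ≟ 0ᵥ
    ... | yes refl = ≤-reflexive (begin-equality
      1 + 1 * s′                        ≡⟨ cong suc (trans (*-identityˡ s′) (sym (*-identityʳ s′))) ⟩
      suc s′ * 1                        ≡⟨ ∑-const 1 ⟨
      ∑ (λ (i : Fin (suc s′)) → 1)       ≡⟨ ∑-cong (λ i → 𝟙-yes (annihilates? (basis i) 0ᵥ) (0ᵥ-annihilates i)) ⟨
      #annihilated 0ᵥ                   ∎)
    ... | no _ =
      let (i , ¬¬annihilates) = Fin.¬∀⟶∃¬ _ _ (λ i → ¬? (annihilates? (basis i) c)) (none ∘ (c ,_))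
      in begin
        1
          ≡⟨ 𝟙-yes (annihilates? (basis i) c) (decidable-stable (annihilates? (basis i) c) ¬¬annihilates) ⟨
        𝟙 (annihilates? (basis i) c)
          ≤⟨ term≤∑ (λ i → 𝟙 (annihilates? (basis i) c)) i ⟩
        #annihilated c ∎

  functional-annihilating-none : ∃ λ c → ∀ i → ¬ (∀ l → dot c (basis i l) ≡ 0#)
  functional-annihilating-none with ∃? annihilates-none?
  ... | yes found = found
  ... | no none = ⊥-elim (counting-bounds-incompatible a m s′ d b ν
                            (trans (sym B≡1+b) (trans B≡A*K (cong₂ _*_ A≡1+a (sym 2+m≡K))))
                            (trans (sym N≡1+ν) (trans N≡B*K (cong₂ _*_ B≡1+b (sym 2+m≡K))))
                            d*b≡b+s′*a s*b+d≤d*ν covered)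
    where
    m : ℕ
    m = proj₁ (m≤n⇒∃[o]m+o≡n 2≤K)
    2+m≡K : 2 + m ≡ K
    2+m≡K = proj₂ (m≤n⇒∃[o]m+o≡n 2≤K)
    covered : ν + suc s′ ≤ suc s′ * (2 + m)
    covered = subst₂ _≤_ (trans (cong (_+ s′) N≡1+ν) (sym (+-suc ν s′))) (cong (suc s′ *_) (sym 2+m≡K))
                         (N+s′≤s*K none)

  -- On the affine hyperplane c · v = 1, which avoids 0, each Mᵢ has B / q points.
  q*∑-hyperplane-mult≡s*B : ∀ c → (∀ i → ¬ (∀ l → dot c (basis i l) ≡ 0#)) →
                            q * ∑ (λ v → 𝟙 (dot c v ≟ 1#) * mult v) ≡ suc s′ * B
  q*∑-hyperplane-mult≡s*B c annihilates-none = begin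
    q * ∑ (λ v → 𝟙 (dot c v ≟ 1#) * mult v)
      ≡⟨ cong (q *_) (∑-weighted-mult (λ v → 𝟙 (dot c v ≟ 1#))) ⟩
    q * ∑ (λ i → ∑ λ v → 𝟙 (dot c v ≟ 1#) * 𝟙 (mem? (M i) v))
      ≡⟨ ∑-*ˡ q _ ⟨
    ∑ (λ i → q * ∑ λ v → 𝟙 (dot c v ≟ 1#) * 𝟙 (mem? (M i) v))
      ≡⟨ ∑-cong q*fibreᵢ≡B ⟩
    ∑ (λ (i : Fin (suc s′)) → B)
      ≡⟨ ∑-const B ⟩
    suc s′ * B ∎
    where
    open ≡-Reasoning
    q*fibreᵢ≡B : ∀ i → q * ∑ (λ v → 𝟙 (dot c v ≟ 1#) * 𝟙 (mem? (M i) v)) ≡ B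
    q*fibreᵢ≡B i =
      let (l , c·bₗ≢0) = Fin.¬∀⟶∃¬ _ _ (λ l → dot c (basis i l) ≟ 0#) (annihilates-none i)
      in begin
        q * ∑ (λ v → 𝟙 (dot c v ≟ 1#) * 𝟙 (mem? (M i) v))
          ≡⟨ cong (q *_) (∑-cong λ v → *-comm (𝟙 (dot c v ≟ 1#)) _) ⟩
        q * fibre (M i) c 1#
          ≡⟨ q*fibre≡∣S∣ (M i) c (proj₁ (proj₂ (dimM i)) l) c·bₗ≢0 1# ⟩
        ∣ M i ∣
          ≡⟨ ∣Mᵢ∣≡B i ⟩
        B ∎

  d∣B : d ∣ B
  d∣B = ∣m+n∣m⇒∣n (subst (d ∣_) (+-comm B (s′ * B)) d∣[1+s′]*B) d∣s′*B
    where
    c : Vect F n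
    c = proj₁ functional-annihilating-none
    pointwise : ∀ v → d ∣ 𝟙 (dot c v ≟ 1#) * mult v
    pointwise v with dot c v ≟ 1#
    ... | no _ = d ∣0
    ... | yes c·v≡1 = subst (d ∣_) (sym (+-identityʳ _)) (d∣mult v≢0)
      where
      v≢0 : v ≢ 0ᵥ
      v≢0 refl = 0≢1 (trans (sym (dot-0ʳ c)) c·v≡1)
    d∣[1+s′]*B : d ∣ suc s′ * B
    d∣[1+s′]*B = subst (d ∣_) (q*∑-hyperplane-mult≡s*B c (proj₂ functional-annihilating-none))
                              (∣n⇒∣m*n q (∣-∑ pointwise))
    d∣s′*B : d ∣ s′ * B
    d∣s′*B = subst (d ∣_) (trans (*-assoc s′ A K) (cong (s′ *_) (sym B≡A*K))) (∣m⇒∣m*n K d∣s′*A)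

proposition5p10 : (p t : ℕ) → Prime p → 1 ≤ t → (F : FiniteField (p ^ t))
    → (n k s d : ℕ) → 1 ≤ k → 2 * k ≤ n → 2 ≤ s → 2 ≤ d
    → (M : Fin s → Subspace F n)
    → (∀ i → HasDim F n (Subspace.mem (M i)) (n ∸ k))
    → (∀ v → v ≢ 0v F n → count F n M v ≡ 0 ⊎ count F n M v ≡ d)
    → (∃ λ v → v ≢ 0v F n × count F n M v ≡ 0)
    → (∃ λ v → v ≢ 0v F n × count F n M v ≡ d)
    → (∀ i j → i ≢ j → HasDim F n (λ v → Subspace.mem (M i) v × Subspace.mem (M j) v) (n ∸ 2 * k))
    → ∃ λ i → d * p ^ i ≡ (p ^ t) ^ (n ∸ 2 * k)
-- The hypotheses 2 ≤ d and that the value d is attained are not needed.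
proposition5p10 _ _ _ _ _ _ _ zero _ _ _ () _ _ _ _ _ _ _
proposition5p10 p t p-prime t≥1 F n k (suc s′) d k≥1 2k≤n _ _ M dimM mult∈0,d (a₀ , a₀≢0 , mult-a₀) _ dimM∩M =
  e ∸ α , (begin
    d * p ^ (e ∸ α)        ≡⟨ cong (_* p ^ (e ∸ α)) d≡p^α ⟩
    p ^ α * p ^ (e ∸ α)    ≡⟨ ^-distribˡ-+-* p α (e ∸ α) ⟨
    p ^ (α + (e ∸ α))      ≡⟨ cong (p ^_) (m+[n∸m]≡n α≤e) ⟩
    p ^ e                  ≡⟨ A≡p^e ⟨
    A                      ∎)
  where
  open ≡-Reasoning
  open Configuration F n k s′ d k≥1 2k≤n M dimM mult∈0,d a₀ a₀≢0 mult-a₀ dimM∩M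
  e : ℕ
  e = t * (n ∸ 2 * k)
  A≡p^e : A ≡ p ^ e
  A≡p^e = ^-*-assoc p t (n ∸ 2 * k)
  d-is-p-power : ∃ λ α → d ≡ p ^ α
  d-is-p-power = ∣p^⇒≡p^ p-prime (t * (n ∸ k)) (subst (d ∣_) (^-*-assoc p t (n ∸ k)) d∣B)
  α : ℕ
  α = proj₁ d-is-p-power
  d≡p^α : d ≡ p ^ α
  d≡p^α = proj₂ d-is-p-power
  α≤e : α ≤ e
  α≤e = p^-exponent-bound p-prime {x = s′} (subst₂ (λ d A → d ∣ s′ * A) d≡p^α A≡p^e d∣s′*A)
          (subst (p ∣_) B≡1+b (∣-trans (m∣m^n t≥1) q∣B)) (subst (λ d → d * b ≡ b + s′ * a) d≡p^α d*b≡b+s′*a)
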